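{- Given a finite set of atomic propositions $P$, for any $n \in \mathbb{N}$ and inquisitive state-pointed modal models $\mathcal{M},s$ and $\mathcal{M}',s'$: \[ \mathcal{M},s\;\sim^n\; \mathcal{M}',s' \iff \mathcal{M},s \equiv^n_{\textsc{InqML}}\mathcal{M}',s'. \]
   Context: An inquisitive state over a set $W$ is a non-empty set $\Pi\subseteq\wp(W)$ closed downward ($s\in\Pi$, $t\subseteq s$ implies $t\in\Pi$). An inquisitive modal model $\mathcal{M}=\langle W,\Sigma,V\rangle$ consists of a set of worlds $W$, a map $\Sigma\colon W\to\wp\wp(W)$ assigning to each world an inquisitive state, and a valuation $V\colon P\to\wp(W)$; put $\sigma(w):=\bigcup\Sigma(w)$. Formulae of inquisitive modal logic $\textsc{InqML}$ are given by $\phi::= p\mid\bot\mid\phi\land\phi\mid\phi\to\phi\mid\phi\mathbin{\bar{\vee}}\phi\mid\Box\phi\mid\boxplus\phi$, where $\mathbin{\bar{\vee}}$ denotes inquisitive disjunction (and $\neg\phi:=\phi\to\bot$, $\phi\lor\psi:=\neg(\neg\phi\land\neg\psi)$). Support at an information state $s\subseteq W$: $s\models p$ iff $s\subseteq V(p)$; $s\models\bot$ iff $s=\emptyset$; $s\models\phi\land\psi$ iff both; $s\models\phi\to\psi$ iff for all $t\subseteq s$, $t\models\phi$ implies $t\models\psi$; $s\models\phi\mathbin{\bar{\vee}}\psi$ iff $s\models\phi$ or $s\models\psi$; $s\models\Box\phi$ iff $\sigma(w)\models\phi$ for all $w\in s$; $s\models\boxplus\phi$ iff $t\models\phi$ for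 all $w\in s$ and all $t\in\Sigma(w)$. $\textsc{InqML}_n$ is the set of formulae of modal depth at most $n$, and $\mathcal{M},s\equiv^n_{\textsc{InqML}}\mathcal{M}',s'$ means $s$ and $s'$ support exactly the same $\textsc{InqML}_n$-formulae. The $n$-round bisimulation game between players I and II alternates between world-positions $\langle w,w'\rangle$ and state-positions $\langle s,s'\rangle$: from a world-position, I picks a state in $\Sigma(w)$ or $\Sigma'(w')$ and II answers with a state in the inquisitive state of the other world; from a state-position, I picks a world in $s$ or $s'$ and II answers with a world in the other state; a round consists of four moves from a world-position to a world-position; a player stuck for a move loses, and II loses at any world-position whose worlds disagree on some atom of $P$; otherwise II wins. $\mathcal{M},w\sim^n\mathcal{M}',w'$ if II has a winning strategy in the $n$-round game from $\langle w,w'\rangle$; for states, $\mathcal{M},s\sim^n\mathcal{M}',s'$ if every world of $s$ is $n$-bisimilar to some world of $s'$ and vice versa. -}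

module Defs where

open import Level using (0ℓ; Lift) renaming (suc to lsuc)
open import Data.Nat using (ℕ; zero; suc; _⊔_; _≤_)
open import Data.Fin using (Fin)
open import Data.Product using (Σ; ∃; _×_; _,_)
open import Data.Empty using (⊥)
open import Relation.Unary using (Pred; _⊆_; _∈_)

State : Set → Set₁
State W = Pred W 0ℓ

record IsInqState {W : Set} (Π : State W → Set) : Set₁ where
  field
    nonEmpty : Σ (State W) Π
    downward : ∀ {s t : State W} → Π s → t ⊆ s → Π t

record Model (k : ℕ) : Set₁ where
  field
    W      : Set
    Σᵐ     : W → State W → Set
    isInq  : ∀ w → IsInqState (Σᵐ w)
    V      : Fin k → State W
    -- σ(w) = ⋃ Σ(w).  Since ⋃ Σ(w) quantifies over states it lives one
    -- universe up; we therefore ask the model to provide σ(w) as a state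
    -- (a level-0 predicate) together with its defining property.
    σ      : W → State W
    σ-spec : ∀ w v → (v ∈ σ w → Σ (State W) (λ t → Σᵐ w t × v ∈ t))
                   × (Σ (State W) (λ t → Σᵐ w t × v ∈ t) → v ∈ σ w)

infixr 6 _∧_
infixr 5 _⩒_
infixr 4 _⇒_

data Form (k : ℕ) : Set where
  atom : Fin k → Form k
  ⊥ᶠ   : Form k
  _∧_  : Form k → Form k → Form k
  _⇒_  : Form k → Form k → Form k
  _⩒_  : Form k → Form k → Form k
  □    : Form k → Form k
  ⊞    : Form k → Form k

md : ∀ {k} → Form k → ℕ
md (atom p) = 0
md ⊥ᶠ       = 0
md (φ ∧ ψ)  = md φ ⊔ md ψ
md (φ ⇒ ψ)  = md φ ⊔ md ψ
md (φ ⩒ ψ)  = md φ ⊔ md ψ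
md (□ φ)    = suc (md φ)
md (⊞ φ)    = suc (md φ)

module _ {k : ℕ} (M : Model k) where
  open Model M

  infix 3 _⊨_
  _⊨_ : State W → Form k → Set₁
  s ⊨ atom p = Lift (lsuc 0ℓ) (s ⊆ V p)
  s ⊨ ⊥ᶠ     = Lift (lsuc 0ℓ) (∀ {w} → w ∈ s → ⊥)
  s ⊨ φ ∧ ψ  = (s ⊨ φ) × (s ⊨ ψ)
  s ⊨ φ ⇒ ψ  = ∀ (t : State W) → t ⊆ s → t ⊨ φ → t ⊨ ψ
  s ⊨ φ ⩒ ψ  = Data.Sum._⊎_ (s ⊨ φ) (s ⊨ ψ)
    where import Data.Sum
  s ⊨ □ φ    = ∀ {w} → w ∈ s → σ w ⊨ φ
  s ⊨ ⊞ φ    = ∀ {w} → w ∈ s → ∀ (t : State W) → Σᵐ w t → t ⊨ φ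

_,_≡ⁿ[_]_,_ : ∀ {k} (M : Model k) → State (Model.W M) → ℕ →
              (M' : Model k) → State (Model.W M') → Set₁
M , s ≡ⁿ[ n ] M' , s' =
  ∀ φ → md φ ≤ n → (_⊨_ M s φ → _⊨_ M' s' φ) × (_⊨_ M' s' φ → _⊨_ M s φ)

-- The n-round bisimulation game.  "II has a winning strategy in the
-- n-round game from ⟨w,w'⟩" is defined by recursion on n, unfolding the
-- moves of a round:  I picks a state in Σ(w) (resp. Σ'(w')), II answers
-- with a state in Σ'(w') (resp. Σ(w)); I picks a world in one of the two
-- states, II answers with a world in the other; II must win the remaining
-- (n-1)-round game.

module _ {k : ℕ} (M M' : Model k) where
  private
    module M  = Model M
    module M' = Model M'

  AtomAgree : M.W → M'.W → Set
  AtomAgree w w' = ∀ (p : Fin k) → (w ∈ M.V p → w' ∈ M'.V p) × (w' ∈ M'.V p → w ∈ M.V p)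

  StateWin : (M.W → M'.W → Set₁) → State M.W → State M'.W → Set₁
  StateWin R t t' =
    (∀ {v}  → v  ∈ t  → Σ M'.W (λ v' → v' ∈ t' × R v v')) ×
    (∀ {v'} → v' ∈ t' → Σ M.W  (λ v  → v  ∈ t  × R v v'))

  Bisim : ℕ → M.W → M'.W → Set₁
  Bisim zero    w w' = Lift (lsuc 0ℓ) (AtomAgree w w')
  Bisim (suc n) w w' =
    Lift (lsuc 0ℓ) (AtomAgree w w') ×
    (∀ (t : State M.W) → M.Σᵐ w t →
       Σ (State M'.W) (λ t' → M'.Σᵐ w' t' × StateWin (Bisim n) t t')) ×
    (∀ (t' : State M'.W) → M'.Σᵐ w' t' →
       Σ (State M.W) (λ t → M.Σᵐ w t × StateWin (Bisim n) t t'))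

_,_∼ⁿ[_]_,_ : ∀ {k} (M : Model k) → State (Model.W M) → ℕ →
              (M' : Model k) → State (Model.W M') → Set₁
M , s ∼ⁿ[ n ] M' , s' = StateWin M M' (Bisim M M' n) s s'

-- The one delicate case
-- is implication: a substate t' ⊆ s' is matched by the substate of s made of
-- the worlds that are n-bisimilar to some world of t'.
--
-- Completeness (≡ⁿ ⇒ ∼ⁿ) rests on the finiteness of P: there is a finite
-- list Γ n of InqML_n-formulae on which agreement of two worlds already
-- forces n-bisimilarity.  The types over a list L (one conjunction of φ or
-- ¬φ for each φ ∈ L) cover all worlds, two worlds of the same type agree on
-- L, and a state supports ¬θ iff none of its worlds realises θ.  For the
-- inquisitive moves, Γ (n+1) contains α S = ⊞ ⩒{¬θ | θ ∈ S} for every set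
-- S of types over Γ n.  If t ∈ Σ(w) is non-empty and S is the set of types
-- realised in t, then w ⊭ α S, hence w' ⊭ α S, which yields t₀ ∈ Σ'(w')
-- realising every type in S; restricting t₀ to the worlds whose type lies in
-- S is II's answer.
module Submission where

open import Defs hiding (_⊨_)
open import Level using (0ℓ; Lift; lift; lower) renaming (suc to lsuc)
open import Axiom.ExcludedMiddle using (ExcludedMiddle)
open import Data.Nat using (ℕ; zero; suc; _≤_; z≤n; s≤s)
open import Data.Nat.Properties using (⊔-lub; m⊔n≤o⇒m≤o; m⊔n≤o⇒n≤o)
open import Data.Fin using (Fin)
open import Data.Product using (Σ; _×_; _,_; proj₁; proj₂; swap; map₂)
open import Data.Sum using (inj₁; inj₂)
open import Data.Empty using (⊥-elim)
open import Data.List using (List; []; _∷_; map; _++_; allFin; filter)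
open import Data.List.Relation.Unary.All as All using (All; []; _∷_)
import Data.List.Relation.Unary.All.Properties as All
open import Data.List.Relation.Unary.Any as Any using (Any; here; there)
import Data.List.Relation.Unary.Any.Properties as Any
open import Data.List.Membership.Propositional using (_∈_; find)
open import Data.List.Membership.Propositional.Properties
  using (∈-map⁺; ∈-++⁺ˡ; ∈-allFin; ∈-filter⁺; ∈-filter⁻)
open import Relation.Nullary using (¬_; yes; no)
open import Relation.Nullary.Decidable using (True; toWitness; fromWitness)
open import Relation.Binary.PropositionalEquality using (refl)
open import Relation.Unary using (Pred; ∅; ｛_｝; Satisfiable; Decidable; _⊆_)

private
  variable
    k : ℕ
    A : Set

infix 3 _,_⊨_
_,_⊨_ : (M : Model k) → State (Model.W M) → Form k → Set₁
M , s ⊨ φ = Defs._⊨_ M s φ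

¬ᶠ : Form k → Form k
¬ᶠ φ = φ ⇒ ⊥ᶠ

⊤ᶠ : Form k
⊤ᶠ = ¬ᶠ ⊥ᶠ

persistence : (M : Model k) (φ : Form k) {s t : State (Model.W M)} →
  M , s ⊨ φ → t ⊆ s → M , t ⊨ φ
persistence M (atom p) s⊨p t⊆s = lift (λ v∈t → lower s⊨p (t⊆s v∈t))
persistence M ⊥ᶠ       s⊨⊥ t⊆s = lift (λ v∈t → lower s⊨⊥ (t⊆s v∈t))
persistence M (φ ∧ ψ) (s⊨φ , s⊨ψ) t⊆s =
  persistence M φ s⊨φ t⊆s , persistence M ψ s⊨ψ t⊆s
persistence M (φ ⇒ ψ) s⊨φ⇒ψ t⊆s u u⊆t = s⊨φ⇒ψ u (λ v∈u → t⊆s (u⊆t v∈u))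
persistence M (φ ⩒ ψ) (inj₁ s⊨φ) t⊆s = inj₁ (persistence M φ s⊨φ t⊆s)
persistence M (φ ⩒ ψ) (inj₂ s⊨ψ) t⊆s = inj₂ (persistence M ψ s⊨ψ t⊆s)
persistence M (□ φ) s⊨□φ t⊆s v∈t = s⊨□φ (t⊆s v∈t)
persistence M (⊞ φ) s⊨⊞φ t⊆s v∈t = s⊨⊞φ (t⊆s v∈t)

∅∈ : {W : Set} {Π : State W → Set} → IsInqState Π → Π ∅
∅∈ inq = IsInqState.downward inq (proj₂ (IsInqState.nonEmpty inq)) (λ ())

Realised : (M : Model k) → State (Model.W M) → Form k → Set₁
Realised M t θ = Σ (Model.W M) λ v → t v × M , ｛ v ｝ ⊨ θ

⊨¬⇒unrealised : (M : Model k) {t : State (Model.W M)} {θ : Form k} →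
  M , t ⊨ ¬ᶠ θ → ¬ Realised M t θ
⊨¬⇒unrealised M t⊨¬θ (v , v∈t , v⊨θ) =
  lower (t⊨¬θ ｛ v ｝ (λ { refl → v∈t }) v⊨θ) refl

unrealised⇒⊨¬ : (M : Model k) {t : State (Model.W M)} (θ : Form k) →
  ¬ Realised M t θ → M , t ⊨ ¬ᶠ θ
unrealised⇒⊨¬ M θ unrealised u u⊆t u⊨θ =
  lift (λ {v} v∈u → unrealised (v , u⊆t v∈u , persistence M θ u⊨θ (λ { refl → v∈u })))

｛｝⊨¬⇒⊭ : (M : Model k) {v : Model.W M} {φ : Form k} →
  M , ｛ v ｝ ⊨ ¬ᶠ φ → ¬ (M , ｛ v ｝ ⊨ φ)
｛｝⊨¬⇒⊭ M {v} v⊨¬φ v⊨φ = ⊨¬⇒unrealised M v⊨¬φ (v , refl , v⊨φ)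

｛｝⊭⇒⊨¬ : (M : Model k) {v : Model.W M} (φ : Form k) →
  ¬ (M , ｛ v ｝ ⊨ φ) → M , ｛ v ｝ ⊨ ¬ᶠ φ
｛｝⊭⇒⊨¬ M φ v⊭φ = unrealised⇒⊨¬ M φ (λ { (_ , refl , v⊨φ) → v⊭φ v⊨φ })

module _ (M M' : Model k) where
  private
    module M  = Model M
    module M' = Model M'

  StateWin-map : {R S : M.W → M'.W → Set₁} → (∀ {v v'} → R v v' → S v v') →
    {t : State M.W} {t' : State M'.W} → StateWin M M' R t t' → StateWin M M' S t t'
  StateWin-map f (fw , bw) =
    (λ v∈t → map₂ (map₂ f) (fw v∈t)) , (λ v'∈t' → map₂ (map₂ f) (bw v'∈t'))

  StateWin-flip : {R : M.W → M'.W → Set₁} {S : M'.W → M.W → Set₁} →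
    (∀ {v v'} → R v v' → S v' v) →
    {t : State M.W} {t' : State M'.W} → StateWin M M' R t t' → StateWin M' M S t' t
  StateWin-flip f win = swap (StateWin-map f win)

Bisim-sym : {M M' : Model k} (n : ℕ) {w : Model.W M} {w' : Model.W M'} →
  Bisim M M' n w w' → Bisim M' M n w' w
Bisim-sym zero    (lift agree) = lift (λ p → swap (agree p))
Bisim-sym {M = M} {M'} (suc n) (lift agree , forth , back) =
  lift (λ p → swap (agree p)) ,
  (λ t' t'∈Σw' → let (t , t∈Σw , win) = back t' t'∈Σw'
                  in t , t∈Σw , StateWin-flip M M' (Bisim-sym n) win) ,
  (λ t t∈Σw → let (t' , t'∈Σw' , win) = forth t t∈Σw
              in t' , t'∈Σw' , StateWin-flip M M' (Bisim-sym n) win)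

∼ⁿ-sym : {M M' : Model k} (n : ℕ) {s : State (Model.W M)} {s' : State (Model.W M')} →
  M , s ∼ⁿ[ n ] M' , s' → M' , s' ∼ⁿ[ n ] M , s
∼ⁿ-sym {M = M} {M'} n = StateWin-flip M M' (Bisim-sym n)

Bisim⇒AtomAgree : {M M' : Model k} (n : ℕ) {w : Model.W M} {w' : Model.W M'} →
  Bisim M M' n w w' → AtomAgree M M' w w'
Bisim⇒AtomAgree zero    (lift agree)     = agree
Bisim⇒AtomAgree (suc n) (lift agree , _) = agree

σ-forth : {M M' : Model k} (n : ℕ) {w : Model.W M} {w' : Model.W M'} →
  Bisim M M' (suc n) w w' → ∀ {u} → Model.σ M w u →
  Σ (Model.W M') λ u' → Model.σ M' w' u' × Bisim M M' n u u'
σ-forth {M = M} {M'} n {w} {w'} (_ , forth , _) {u} u∈σw =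
  let (t , t∈Σw , u∈t)       = proj₁ (Model.σ-spec M w u) u∈σw
      (t' , t'∈Σw' , fw , _) = forth t t∈Σw
      (u' , u'∈t' , bisim)   = fw u∈t
  in u' , proj₂ (Model.σ-spec M' w' u') (t' , t'∈Σw' , u'∈t') , bisim

∼ⁿ-σ : {M M' : Model k} (n : ℕ) {w : Model.W M} {w' : Model.W M'} →
  Bisim M M' (suc n) w w' → M , Model.σ M w ∼ⁿ[ n ] M' , Model.σ M' w'
∼ⁿ-σ n bisim =
  σ-forth n bisim ,
  λ u'∈σw' → let (u , u∈σw , bisim') = σ-forth n (Bisim-sym (suc n) bisim) u'∈σw'
             in u , u∈σw , Bisim-sym n bisim'

⩒[_] : List (Form k) → Form k
⩒[ [] ]    = ⊥ᶠ
⩒[ φ ∷ L ] = φ ⩒ ⩒[ L ]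

types : List (Form k) → List (Form k)
types []      = ⊤ᶠ ∷ []
types (φ ∷ L) = map (φ ∧_) (types L) ++ map (¬ᶠ φ ∧_) (types L)

α : List (Form k) → Form k
α S = ⊞ ⩒[ map ¬ᶠ S ]

sublists : List A → List (List A)
sublists []       = [] ∷ []
sublists (x ∷ xs) = map (x ∷_) (sublists xs) ++ sublists xs

atoms : List (Form k)
atoms = map atom (allFin _)

md-atoms : {n : ℕ} → All (λ φ → md φ ≤ n) (atoms {k})
md-atoms = All.map⁺ (All.universal (λ _ → z≤n) _)

Γ : ℕ → List (Form k)
Γ zero    = atoms
Γ (suc n) = atoms ++ map α (sublists (types (Γ n)))

atom∈Γ : (n : ℕ) (p : Fin k) → atom p ∈ Γ n
atom∈Γ zero    p = ∈-map⁺ atom (∈-allFin p)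
atom∈Γ (suc n) p = ∈-++⁺ˡ (atom∈Γ zero p)

α∈Γ : (n : ℕ) {S : List (Form k)} → S ∈ sublists (types (Γ n)) → α S ∈ Γ (suc n)
α∈Γ n S∈ = Any.++⁺ʳ atoms (∈-map⁺ α S∈)

filter∈sublists : {P : Pred A (lsuc 0ℓ)} (P? : Decidable P) (xs : List A) →
  filter P? xs ∈ sublists xs
filter∈sublists P? []       = here refl
filter∈sublists P? (x ∷ xs) with P? x
... | yes _ = ∈-++⁺ˡ (∈-map⁺ (x ∷_) (filter∈sublists P? xs))
... | no  _ = Any.++⁺ʳ (map (x ∷_) (sublists xs)) (filter∈sublists P? xs)

All-sublists : {P : Pred A 0ℓ} {xs : List A} → All P xs → All (All P) (sublists xs)
All-sublists []       = [] ∷ []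
All-sublists (p ∷ ps) =
  All.++⁺ (All.map⁺ (All.map (p ∷_) (All-sublists ps))) (All-sublists ps)

md-⩒[] : {n : ℕ} {L : List (Form k)} → All (λ φ → md φ ≤ n) L → md ⩒[ L ] ≤ n
md-⩒[] []       = z≤n
md-⩒[] (h ∷ hs) = ⊔-lub h (md-⩒[] hs)

md-types : {n : ℕ} {L : List (Form k)} → All (λ φ → md φ ≤ n) L →
  All (λ θ → md θ ≤ n) (types L)
md-types []       = z≤n ∷ []
md-types (h ∷ hs) =
  All.++⁺ (All.map⁺ (All.map (⊔-lub h) (md-types hs)))
          (All.map⁺ (All.map (⊔-lub (⊔-lub h z≤n)) (md-types hs)))

md-Γ : (n : ℕ) → All (λ φ → md φ ≤ n) (Γ {k} n)
md-Γ zero    = md-atoms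
md-Γ (suc n) =
  All.++⁺ md-atoms
    (All.map⁺ (All.map md-α (All-sublists (md-types (md-Γ n)))))
  where
    md-α : {S : List (Form k)} → All (λ θ → md θ ≤ n) S → md (α S) ≤ suc n
    md-α bound = s≤s (md-⩒[] (All.map⁺ (All.map (λ h → ⊔-lub h z≤n) bound)))

module _ (M M' : Model k) where
  private
    module M  = Model M
    module M' = Model M'

  AgreeOn : List (Form k) → M.W → M'.W → Set₁
  AgreeOn L v v' =
    All (λ φ → (M , ｛ v ｝ ⊨ φ → M' , ｛ v' ｝ ⊨ φ) × (M' , ｛ v' ｝ ⊨ φ → M , ｛ v ｝ ⊨ φ)) L

  AgreeOn⇒AtomAgree : {L : List (Form k)} → (∀ p → atom p ∈ L) →
    ∀ {v v'} → AgreeOn L v v' → AtomAgree M M' v v'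
  AgreeOn⇒AtomAgree atom∈L agree p =
    (λ v∈Vp  → lower (proj₁ (All.lookup agree (atom∈L p)) (lift λ { refl → v∈Vp })) refl) ,
    (λ v'∈Vp → lower (proj₂ (All.lookup agree (atom∈L p)) (lift λ { refl → v'∈Vp })) refl)

  same-type⇒AgreeOn : (L : List (Form k)) {v : M.W} {v' : M'.W} {θ : Form k} →
    θ ∈ types L → M , ｛ v ｝ ⊨ θ → M' , ｛ v' ｝ ⊨ θ → AgreeOn L v v'
  same-type⇒AgreeOn L = All.lookup (types-force-agreement L)
    where
      types-force-agreement : (L : List (Form k)) {v : M.W} {v' : M'.W} →
        All (λ θ → M , ｛ v ｝ ⊨ θ → M' , ｛ v' ｝ ⊨ θ → AgreeOn L v v') (types L)
      types-force-agreement []      = (λ _ _ → []) ∷ []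
      types-force-agreement (φ ∷ L) {v} {v'} =
        All.++⁺
          (All.map⁺ (All.map (λ agree (v⊨φ , v⊨θ) (v'⊨φ , v'⊨θ) →
                                ((λ _ → v'⊨φ) , (λ _ → v⊨φ)) ∷ agree v⊨θ v'⊨θ)
                             (types-force-agreement L)))
          (All.map⁺ (All.map (λ agree (v⊨¬φ , v⊨θ) (v'⊨¬φ , v'⊨θ) →
                                ( (λ v⊨φ  → ⊥-elim (｛｝⊨¬⇒⊭ M  v⊨¬φ  v⊨φ))
                                , (λ v'⊨φ → ⊥-elim (｛｝⊨¬⇒⊭ M' v'⊨¬φ v'⊨φ)))
                                ∷ agree v⊨θ v'⊨θ)
                             (types-force-agreement L)))

AgreeOn-sym : (M M' : Model k) {L : List (Form k)} {v : Model.W M} {v' : Model.W M'} →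
  AgreeOn M M' L v v' → AgreeOn M' M L v' v
AgreeOn-sym M M' = All.map swap

realised⇒⊭⩒¬ : (M : Model k) {t : State (Model.W M)} {S : List (Form k)} →
  (∀ {θ} → θ ∈ S → Realised M t θ) → Satisfiable t → ¬ (M , t ⊨ ⩒[ map ¬ᶠ S ])
realised⇒⊭⩒¬ M {S = []}    _        (_ , v∈t) t⊨⊥ = lower t⊨⊥ v∈t
realised⇒⊭⩒¬ M {S = θ ∷ S} realised _ (inj₁ t⊨¬θ) =
  ⊨¬⇒unrealised M t⊨¬θ (realised (here refl))
realised⇒⊭⩒¬ M {S = θ ∷ S} realised t≠∅ (inj₂ t⊨⩒) =
  realised⇒⊭⩒¬ M (λ θ∈S → realised (there θ∈S)) t≠∅ t⊨⩒

module Classical (em : ExcludedMiddle (lsuc 0ℓ)) where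

  -- States are level-0 predicates, so a state can only be carved out of
  -- another by a Set₁-condition after resizing the condition to Set.
  resize : Set₁ → Set
  resize P = True (em {P})

  restrict : {W : Set} → State W → (W → Set₁) → State W
  restrict s P v = s v × resize (P v)

  StateWin-⊆ʳ : (M M' : Model k) {R : Model.W M → Model.W M' → Set₁}
    {s : State (Model.W M)} {s' t' : State (Model.W M')} →
    StateWin M M' R s s' → t' ⊆ s' →
    Σ (State (Model.W M)) λ t → t ⊆ s × StateWin M M' R t t'
  StateWin-⊆ʳ M M' {R} {s} {t' = t'} (_ , bw) t'⊆s' =
    restrict s (λ v → Σ (Model.W M') λ v' → t' v' × R v v') , proj₁ ,
    (λ (_ , partner) → toWitness partner) ,
    (λ v'∈t' → let (v , v∈s , r) = bw (t'⊆s' v'∈t')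
               in v , (v∈s , fromWitness (_ , v'∈t' , r)) , r)

  ⊨-transfer : {M M' : Model k} (n : ℕ) (φ : Form k) → md φ ≤ n →
    {s : State (Model.W M)} {s' : State (Model.W M')} →
    M , s ∼ⁿ[ n ] M' , s' → M , s ⊨ φ → M' , s' ⊨ φ
  ⊨-transfer n (atom p) _ (_ , bw) s⊨p =
    lift λ v'∈s' → let (v , v∈s , bisim) = bw v'∈s'
                   in proj₁ (Bisim⇒AtomAgree n bisim p) (lower s⊨p v∈s)
  ⊨-transfer n ⊥ᶠ _ (_ , bw) s⊨⊥ = lift λ v'∈s' → lower s⊨⊥ (proj₁ (proj₂ (bw v'∈s')))
  ⊨-transfer n (φ ∧ ψ) md≤n win (s⊨φ , s⊨ψ) =
    ⊨-transfer n φ (m⊔n≤o⇒m≤o _ _ md≤n) win s⊨φ ,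
    ⊨-transfer n ψ (m⊔n≤o⇒n≤o _ _ md≤n) win s⊨ψ
  ⊨-transfer n (φ ⩒ ψ) md≤n win (inj₁ s⊨φ) =
    inj₁ (⊨-transfer n φ (m⊔n≤o⇒m≤o _ _ md≤n) win s⊨φ)
  ⊨-transfer n (φ ⩒ ψ) md≤n win (inj₂ s⊨ψ) =
    inj₂ (⊨-transfer n ψ (m⊔n≤o⇒n≤o _ _ md≤n) win s⊨ψ)
  ⊨-transfer {M = M} {M'} n (φ ⇒ ψ) md≤n win s⊨φ⇒ψ t' t'⊆s' t'⊨φ =
    let (t , t⊆s , win') = StateWin-⊆ʳ M M' win t'⊆s'
        t⊨φ = ⊨-transfer n φ (m⊔n≤o⇒m≤o _ _ md≤n) (∼ⁿ-sym n win') t'⊨φ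
    in ⊨-transfer n ψ (m⊔n≤o⇒n≤o _ _ md≤n) win' (s⊨φ⇒ψ t t⊆s t⊨φ)
  ⊨-transfer (suc n) (□ φ) (s≤s md≤n) (_ , bw) s⊨□φ v'∈s' =
    let (v , v∈s , bisim) = bw v'∈s'
    in ⊨-transfer n φ md≤n (∼ⁿ-σ n bisim) (s⊨□φ v∈s)
  ⊨-transfer (suc n) (⊞ φ) (s≤s md≤n) (_ , bw) s⊨⊞φ v'∈s' t' t'∈Σv' =
    let (v , v∈s , _ , _ , back) = bw v'∈s'
        (t , t∈Σv , win)        = back t' t'∈Σv'
    in ⊨-transfer n φ md≤n win (s⊨⊞φ v∈s t t∈Σv)

  ∼ⁿ⇒≡ⁿ : {M M' : Model k} (n : ℕ) {s : State (Model.W M)} {s' : State (Model.W M')} →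
    M , s ∼ⁿ[ n ] M' , s' → M , s ≡ⁿ[ n ] M' , s'
  ∼ⁿ⇒≡ⁿ n win φ md≤n = ⊨-transfer n φ md≤n win , ⊨-transfer n φ md≤n (∼ⁿ-sym n win)

  ⊭¬⇒realised : (M : Model k) {t : State (Model.W M)} (θ : Form k) →
    ¬ (M , t ⊨ ¬ᶠ θ) → Realised M t θ
  ⊭¬⇒realised M θ t⊭¬θ with em {Realised M _ θ}
  ... | yes realised  = realised
  ... | no unrealised = ⊥-elim (t⊭¬θ (unrealised⇒⊨¬ M θ unrealised))

  ⊭⩒¬⇒realised : (M : Model k) {t : State (Model.W M)} {S : List (Form k)} →
    ¬ (M , t ⊨ ⩒[ map ¬ᶠ S ]) → ∀ {θ} → θ ∈ S → Realised M t θ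
  ⊭⩒¬⇒realised M {S = θ ∷ S} t⊭⩒ (here refl) =
    ⊭¬⇒realised M θ (λ t⊨¬θ → t⊭⩒ (inj₁ t⊨¬θ))
  ⊭⩒¬⇒realised M {S = θ ∷ S} t⊭⩒ (there θ∈S) =
    ⊭⩒¬⇒realised M (λ t⊨⩒ → t⊭⩒ (inj₂ t⊨⩒)) θ∈S

  Counterexample : (M : Model k) → Model.W M → Form k → Set₁
  Counterexample M w φ = Σ (State (Model.W M)) λ t → Model.Σᵐ M w t × ¬ (M , t ⊨ φ)

  ⊭⊞⇒counterexample : (M : Model k) {w : Model.W M} (φ : Form k) →
    ¬ (M , ｛ w ｝ ⊨ ⊞ φ) → Counterexample M w φ
  ⊭⊞⇒counterexample M {w} φ w⊭⊞φ with em {Counterexample M w φ}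
  ... | yes counterexample = counterexample
  ... | no none = ⊥-elim (w⊭⊞φ w⊨⊞φ)
    where
      w⊨⊞φ : M , ｛ w ｝ ⊨ ⊞ φ
      w⊨⊞φ refl t t∈Σw with em {M , t ⊨ φ}
      ... | yes t⊨φ = t⊨φ
      ... | no  t⊭φ = ⊥-elim (none (t , t∈Σw , t⊭φ))

  realised? : (M : Model k) (t : State (Model.W M)) → Decidable (Realised M t)
  realised? M t θ = em

  realised-types : (M : Model k) → State (Model.W M) → List (Form k) → List (Form k)
  realised-types M t L = filter (realised? M t) (types L)

  type-exists : (M : Model k) (L : List (Form k)) (v : Model.W M) →
    Any (λ θ → M , ｛ v ｝ ⊨ θ) (types L)
  type-exists M []      v = here (λ _ _ u⊨⊥ → u⊨⊥)
  type-exists M (φ ∷ L) v with em {M , ｛ v ｝ ⊨ φ}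
  ... | yes v⊨φ = Any.++⁺ˡ (Any.map⁺ (Any.map (v⊨φ ,_) (type-exists M L v)))
  ... | no  v⊭φ = Any.++⁺ʳ (map (φ ∧_) (types L))
                    (Any.map⁺ (Any.map (｛｝⊭⇒⊨¬ M φ v⊭φ ,_) (type-exists M L v)))

  module _ (M M' : Model k) where
    private
      module M  = Model M
      module M' = Model M'

    TypeRestriction : List (Form k) → State M.W → State M'.W → State M'.W
    TypeRestriction L t t₀ =
      restrict t₀ λ v' → Σ (Form k) λ θ → θ ∈ types L × Realised M t θ × M' , ｛ v' ｝ ⊨ θ

    type-matching-substate : (L : List (Form k)) {t : State M.W} {t₀ : State M'.W} →
      (∀ {θ} → θ ∈ types L → Realised M t θ → Realised M' t₀ θ) →
      StateWin M M' (AgreeOn M M' L) t (TypeRestriction L t t₀)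
    type-matching-substate L {t} {t₀} realised-in-t₀ = fw , bw
      where
        fw : ∀ {v} → t v → Σ M'.W λ v' → TypeRestriction L t t₀ v' × AgreeOn M M' L v v'
        fw {v} v∈t =
          let (θ , θ∈ , v⊨θ)     = find (type-exists M L v)
              (v' , v'∈t₀ , v'⊨θ) = realised-in-t₀ θ∈ (v , v∈t , v⊨θ)
          in v' , (v'∈t₀ , fromWitness (θ , θ∈ , (v , v∈t , v⊨θ) , v'⊨θ)) ,
             same-type⇒AgreeOn M M' L θ∈ v⊨θ v'⊨θ
        bw : ∀ {v'} → TypeRestriction L t t₀ v' → Σ M.W λ v → t v × AgreeOn M M' L v v'
        bw (_ , type-of-v'-realised-in-t) =
          let (θ , θ∈ , (v , v∈t , v⊨θ) , v'⊨θ) = toWitness type-of-v'-realised-in-t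
          in v , v∈t , same-type⇒AgreeOn M M' L θ∈ v⊨θ v'⊨θ

    AgreeOn-forth : (L : List (Form k)) {w : M.W} {w' : M'.W} →
      (∀ {S} → S ∈ sublists (types L) → M' , ｛ w' ｝ ⊨ α S → M , ｛ w ｝ ⊨ α S) →
      ∀ t → M.Σᵐ w t →
      Σ (State M'.W) λ t' → M'.Σᵐ w' t' × StateWin M M' (AgreeOn M M' L) t t'
    AgreeOn-forth L {w} {w'} α-back t t∈Σw with em {Lift (lsuc 0ℓ) (Satisfiable t)}
    ... | no t=∅ = ∅ , ∅∈ (M'.isInq w') , (λ v∈t → ⊥-elim (t=∅ (lift (_ , v∈t)))) , λ ()
    ... | yes (lift t≠∅) with ⊭⊞⇒counterexample M' ⩒[ map ¬ᶠ (realised-types M t L) ] w'⊭αS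
      where
        w'⊭αS : ¬ (M' , ｛ w' ｝ ⊨ α (realised-types M t L))
        w'⊭αS w'⊨αS =
          realised⇒⊭⩒¬ M {S = realised-types M t L}
            (λ θ∈S → proj₂ (∈-filter⁻ (realised? M t) {xs = types L} θ∈S)) t≠∅
            (α-back (filter∈sublists (realised? M t) (types L)) w'⊨αS refl t t∈Σw)
    ... | t₀ , t₀∈Σw' , t₀⊭⩒¬S =
      _ , IsInqState.downward (M'.isInq w') t₀∈Σw' proj₁ ,
      type-matching-substate L
        (λ θ∈ realised → ⊭⩒¬⇒realised M' t₀⊭⩒¬S (∈-filter⁺ (realised? M t) θ∈ realised))

  AgreeOn⇒Bisim : {M M' : Model k} (n : ℕ) {v : Model.W M} {v' : Model.W M'} →
    AgreeOn M M' (Γ n) v v' → Bisim M M' n v v'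
  AgreeOn⇒Bisim {M = M} {M'} zero agree = lift (AgreeOn⇒AtomAgree M M' (atom∈Γ zero) agree)
  AgreeOn⇒Bisim {M = M} {M'} (suc n) agree =
    lift (AgreeOn⇒AtomAgree M M' (atom∈Γ (suc n)) agree) ,
    (λ t t∈Σv →
      let (t' , t'∈Σv' , win) =
            AgreeOn-forth M M' (Γ n) (λ S∈ → proj₂ (All.lookup agree (α∈Γ n S∈))) t t∈Σv
      in t' , t'∈Σv' , StateWin-map M M' (AgreeOn⇒Bisim n) win) ,
    (λ t' t'∈Σv' →
      let (t , t∈Σv , win) =
            AgreeOn-forth M' M (Γ n) (λ S∈ → proj₁ (All.lookup agree (α∈Γ n S∈))) t' t'∈Σv'
      in t , t∈Σv , StateWin-flip M' M (λ agree' → AgreeOn⇒Bisim n (AgreeOn-sym M' M agree')) win)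

  ≡ⁿ⇒forth : {M M' : Model k} (n : ℕ) {s : State (Model.W M)} {s' : State (Model.W M')} →
    M , s ≡ⁿ[ n ] M' , s' → ∀ {v} → s v → Σ (Model.W M') λ v' → s' v' × Bisim M M' n v v'
  ≡ⁿ⇒forth {M = M} {M'} n equiv {v} v∈s =
    let (θ , θ∈ , v⊨θ) = find (type-exists M (Γ n) v)
        md¬θ≤n = ⊔-lub (All.lookup (md-types (md-Γ n)) θ∈) z≤n
        s'⊭¬θ s'⊨¬θ =
          ⊨¬⇒unrealised M (proj₂ (equiv (¬ᶠ θ) md¬θ≤n) s'⊨¬θ) (v , v∈s , v⊨θ)
        (v' , v'∈s' , v'⊨θ) = ⊭¬⇒realised M' θ s'⊭¬θ
    in v' , v'∈s' , AgreeOn⇒Bisim n (same-type⇒AgreeOn M M' (Γ n) θ∈ v⊨θ v'⊨θ)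

  ≡ⁿ⇒∼ⁿ : {M M' : Model k} (n : ℕ) {s : State (Model.W M)} {s' : State (Model.W M')} →
    M , s ≡ⁿ[ n ] M' , s' → M , s ∼ⁿ[ n ] M' , s'
  ≡ⁿ⇒∼ⁿ n equiv =
    ≡ⁿ⇒forth n equiv ,
    λ v'∈s' → let (v , v∈s , bisim) = ≡ⁿ⇒forth n (λ φ md≤n → swap (equiv φ md≤n)) v'∈s'
              in v , v∈s , Bisim-sym n bisim

theorem1 : ExcludedMiddle (lsuc 0ℓ) →
    ∀ {k : ℕ} (n : ℕ) (M M' : Model k)
      (s : State (Model.W M)) (s' : State (Model.W M')) →
      ((M , s ∼ⁿ[ n ] M' , s') → (M , s ≡ⁿ[ n ] M' , s')) ×
      ((M , s ≡ⁿ[ n ] M' , s') → (M , s ∼ⁿ[ n ] M' , s'))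
theorem1 em n M M' s s' = ∼ⁿ⇒≡ⁿ n , ≡ⁿ⇒∼ⁿ n
  where open Classical em
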